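{- Let $G$ be a finite, simple, undirected, connected graph, let $c\geq 0$ be an integer, and let $\mathcal{P}$ be a $c$-sharp partition of $G$. Let $H=G(\mathcal{P})$ be the partition-graph and $\varphi:V(G)\to V(H)$ the natural mapping. Then $\varphi$ is a $(c+1,1,0)$-quasi-isometry.
   Context: Distances $d_G$, $d_H$ are shortest-path distances (number of edges). A partition of $G$ is a partition of $V(G)$ into nonempty subsets (super-vertices), each of which induces a connected subgraph of $G$. The partition-graph $G(\mathcal{P})$ has the super-vertices as vertices, two distinct super-vertices $P_i,P_j$ being adjacent iff there exist $x\in P_i$, $y\in P_j$ with $x\sim y$ in $G$. The natural mapping is $\varphi(v)=\overline{v}$, the super-vertex containing $v$. The partition is $c$-sharp if every super-vertex, as a (connected induced) subgraph, has diameter at most $c$. For metric spaces $(M_1,d_1),(M_2,d_2)$ and non-negative integers $A,B,C$ with $A\ge 1$, a map $f:M_1\to M_2$ is an $(A,B,C)$-quasi-isometry if (Q1) for all $x,y\in M_1$: $\frac1A d_1(x,y)-B\le d_2(f(x),f(y))\le A\,d_1(x,y)+B$, and (Q2) for every $y\in M_2$ there is $x\in M_1$ with $d_2(y,f(x))\le C$. -}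

module Defs where

open import Data.Nat using (ℕ; zero; suc; _+_; _*_; _≤_)
open import Data.Fin using (Fin)
open import Data.Product using (Σ; ∃; _×_; _,_; proj₁)
open import Relation.Binary.PropositionalEquality using (_≡_)
open import Relation.Nullary using (¬_)

record SimpleGraph (n : ℕ) : Set₁ where
  field
    Adj    : Fin n → Fin n → Set
    sym    : ∀ {x y} → Adj x y → Adj y x
    irrefl : ∀ {x} → ¬ Adj x x

open SimpleGraph public

data Walk {A : Set} (R : A → A → Set) : A → A → ℕ → Set where
  here : ∀ {x} → Walk R x x zero
  step : ∀ {x y z k} → R x y → Walk R y z k → Walk R x z (suc k)

Dist : {A : Set} (R : A → A → Set) → A → A → ℕ → Set
Dist R x y k = Walk R x y k × (∀ {l} → Walk R x y l → k ≤ l)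

Connected : {A : Set} (R : A → A → Set) → Set
Connected {A} R = ∀ (x y : A) → ∃ λ k → Walk R x y k

-- A partition of G into m super-vertices, given by the natural map p : V(G) → Fin m
-- (p v = the super-vertex containing v).
-- Super-vertex i as a vertex set:
Part : ∀ {n m} → (Fin n → Fin m) → Fin m → Set
Part {n} p i = Σ (Fin n) (λ v → p v ≡ i)

InducedAdj : ∀ {n m} (G : SimpleGraph n) (p : Fin n → Fin m) (i : Fin m) →
             Part p i → Part p i → Set
InducedAdj G p i a b = Adj G (proj₁ a) (proj₁ b)

IsPartition : ∀ {n m} (G : SimpleGraph n) (p : Fin n → Fin m) → Set
IsPartition {n} {m} G p =
  (∀ (i : Fin m) → Σ (Fin n) (λ v → p v ≡ i)) ×
  (∀ (i : Fin m) → Connected (InducedAdj G p i))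

IsSharp : ∀ {n m} (G : SimpleGraph n) (p : Fin n → Fin m) (c : ℕ) → Set
IsSharp G p c = ∀ i (a b : Part p i) k → Dist (InducedAdj G p i) a b k → k ≤ c

PartAdj : ∀ {n m} (G : SimpleGraph n) (p : Fin n → Fin m) → Fin m → Fin m → Set
PartAdj {n} G p i j =
  ¬ (i ≡ j) × ∃ λ (x : Fin n) → ∃ λ (y : Fin n) → p x ≡ i × p y ≡ j × Adj G x y

-- (A,B,C)-quasi-isometry between graph metrics (shortest-path distances).
-- (Q1) lower bound (1/A) d1 - B ≤ d2 is written, after multiplying by A ≥ 1,
-- as d1 ≤ A * (d2 + B), which is equivalent over ℕ.
IsQuasiIsometry : {X Y : Set} (R₁ : X → X → Set) (R₂ : Y → Y → Set) →
                  (X → Y) → (A B C : ℕ) → Set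
IsQuasiIsometry {X} {Y} R₁ R₂ f A B C =
  (1 ≤ A) ×
  (∀ (x y : X) (d₁ d₂ : ℕ) → Dist R₁ x y d₁ → Dist R₂ (f x) (f y) d₂ →
     (d₁ ≤ A * (d₂ + B)) × (d₂ ≤ A * d₁ + B)) ×
  (∀ (y : Y) → ∃ λ (x : X) → ∃ λ (d : ℕ) → Dist R₂ y (f x) d × d ≤ C)

module Submission where

-- A walk in G projects to a walk in G(P) that is no longer (steps inside a super-vertex are
-- dropped), so d_H(φx, φy) ≤ d_G(x, y). Conversely a walk of length k in G(P) lifts to a walk
-- in G: each of its k edges is realised by an edge of G, and the k + 1 super-vertices it visits
-- are crossed by walks of length at most c, giving d_G(x, y) ≤ c + k (c + 1) < (c + 1)(k + 1).
-- Since super-vertices are nonempty, φ is surjective.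

open import Defs hiding (sym)
open import Data.Nat using (ℕ; suc; _+_; _*_; _≤_; s≤s; z≤n; _≤?_)
open import Data.Nat.Induction using (<-rec)
open import Data.Nat.Properties
open import Data.Fin using (Fin) renaming (_≟_ to _≟ᶠ_)
open import Data.Product using (∃; _×_; _,_; proj₁; proj₂)
open import Effect.Monad using (RawMonad)
open import Level using (0ℓ)
open import Relation.Nullary using (¬_; yes; no)
open import Relation.Nullary.Decidable using (decidable-stable)
open import Relation.Nullary.Negation using (DoubleNegation; ¬¬-Monad)
open import Relation.Binary.PropositionalEquality using (_≡_; refl; sym; subst; cong; module ≡-Reasoning)

open RawMonad (¬¬-Monad {0ℓ})

module _ {A : Set} {R : A → A → Set} where

  _++ʷ_ : ∀ {x y z k l} → Walk R x y k → Walk R y z l → Walk R x z (k + l)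
  here       ++ʷ w = w
  step r v   ++ʷ w = step r (v ++ʷ w)

  noShortest⇒noWalk : ∀ {a b} → ¬ (∃ λ k → Dist R a b k) → ∀ l → ¬ Walk R a b l
  noShortest⇒noWalk noDist = <-rec _ λ l noShorter w →
    noDist (l , w , λ w′ → ≮⇒≥ (λ l′<l → noShorter l′<l w′))

  -- R is not assumed decidable, so a shortest walk exists only classically; this is harmless
  -- because everything finally derived from it is a decidable inequality on ℕ.
  shortest-walk : ∀ {a b k} → Walk R a b k → DoubleNegation (∃ λ l → Dist R a b l)
  shortest-walk w noDist = noShortest⇒noWalk noDist _ w

module _ {n m : ℕ} (G : SimpleGraph n) (p : Fin n → Fin m) where

  induced⇒walk : ∀ {i} {a b : Part p i} {k} → Walk (InducedAdj G p i) a b k →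
                 Walk (Adj G) (proj₁ a) (proj₁ b) k
  induced⇒walk here       = here
  induced⇒walk (step r w) = step r (induced⇒walk w)

  project-walk : ∀ {x y k} → Walk (Adj G) x y k →
                 ∃ λ l → l ≤ k × Walk (PartAdj G p) (p x) (p y) l
  project-walk here = 0 , z≤n , here
  project-walk {x} {z} (step {y = y} x~y w) with project-walk w | p x ≟ᶠ p y
  ... | l , l≤k , w′ | yes px≡py =
    l , m≤n⇒m≤1+n l≤k , subst (λ i → Walk (PartAdj G p) i (p z) l) (sym px≡py) w′
  ... | l , l≤k , w′ | no  px≢py =
    suc l , s≤s l≤k , step (px≢py , x , y , refl , refl , x~y) w′

  module _ (c : ℕ) (blocksConnected : ∀ i → Connected (InducedAdj G p i)) (sharp : IsSharp G p c) where

    walk-inBlock : ∀ {i x y} → p x ≡ i → p y ≡ i →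
                   DoubleNegation (∃ λ l → Walk (Adj G) x y l × l ≤ c)
    walk-inBlock {i} {x} {y} px≡i py≡i = do
      (l , dist) ← shortest-walk (proj₂ (blocksConnected i (x , px≡i) (y , py≡i)))
      pure (l , induced⇒walk (proj₁ dist) , sharp i (x , px≡i) (y , py≡i) l dist)

    lift-walk : ∀ {i j k x y} → Walk (PartAdj G p) i j k → p x ≡ i → p y ≡ j →
                DoubleNegation (∃ λ l → Walk (Adj G) x y l × l ≤ c + k * suc c)
    lift-walk here px≡i py≡i = do
      (l , w , l≤c) ← walk-inBlock px≡i py≡i
      pure (l , w , ≤-trans l≤c (m≤m+n c 0))
    lift-walk (step (_ , u , v , pu≡i , pv≡i′ , u~v) rest) px≡i py≡j = do
      (l₁ , w₁ , l₁≤) ← walk-inBlock px≡i pu≡i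
      (l₂ , w₂ , l₂≤) ← lift-walk rest pv≡i′ py≡j
      pure (l₁ + suc l₂ , w₁ ++ʷ step u~v w₂ , +-mono-≤ l₁≤ (s≤s l₂≤))

lift-bound≤ : ∀ c k → c + k * suc c ≤ suc c * (k + 1)
lift-bound≤ c k = ≤-trans (n≤1+n _) (≤-reflexive (begin
  suc c + k * suc c   ≡⟨⟩
  suc k * suc c       ≡⟨ cong (_* suc c) (+-comm 1 k) ⟩
  (k + 1) * suc c     ≡⟨ *-comm (k + 1) (suc c) ⟩
  suc c * (k + 1)     ∎))
  where open ≡-Reasoning

theorem2 : ∀ {n m : ℕ} (G : SimpleGraph n) → Connected (Adj G) →
    (c : ℕ) (p : Fin n → Fin m) → IsPartition G p → IsSharp G p c →
    IsQuasiIsometry (Adj G) (PartAdj G p) p (suc c) 1 0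
theorem2 G _ c p (nonempty , blocksConnected) sharp = s≤s z≤n , distortion , surjective
  where
  distortion : ∀ x y d₁ d₂ → Dist (Adj G) x y d₁ → Dist (PartAdj G p) (p x) (p y) d₂ →
               (d₁ ≤ suc c * (d₂ + 1)) × (d₂ ≤ suc c * d₁ + 1)
  distortion x y d₁ d₂ (w₁ , shortest₁) (w₂ , shortest₂) = lower , upper
    where
    lower : d₁ ≤ suc c * (d₂ + 1)
    lower = decidable-stable (d₁ ≤? _) do
      (l , w , l≤) ← lift-walk G p c blocksConnected sharp w₂ refl refl
      pure (≤-trans (shortest₁ w) (≤-trans l≤ (lift-bound≤ c d₂)))
    upper : d₂ ≤ suc c * d₁ + 1
    upper with project-walk G p w₁
    ... | l , l≤d₁ , w =
      ≤-trans (shortest₂ w) (≤-trans l≤d₁ (≤-trans (m≤m+n d₁ (c * d₁)) (m≤m+n _ 1)))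
  surjective : ∀ i → ∃ λ x → ∃ λ d → Dist (PartAdj G p) i (p x) d × d ≤ 0
  surjective i with nonempty i
  ... | x , refl = x , 0 , (here , λ _ → z≤n) , z≤n
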